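{- Let $q$ be a prime power, let $s,m\ge1$ be integers and $\mathbf{e}\in\mathbb{N}^s$. Let a system $\{\mathbf{c}^{(i)}_j\in\mathbb{F}_q^m:1\le j\le m,\ 1\le i\le s\}$ be given, let $C_i$ ($1\le i\le s$) be the $m\times m$ matrix with column vectors $\mathbf{c}^{(i)}_1,\dots,\mathbf{c}^{(i)}_m$, let $C=(C_1\mid C_2\mid\cdots\mid C_s)\in\mathbb{F}_q^{m\times sm}$, let $\mathcal{C}\subseteq\mathbb{F}_q^{sm}$ be the row space of $C$ and $\mathcal{C}^\perp$ its dual space. Let $d\in\{0,\dots,m\}$ be an integer. Then: (a) If the system is a $(d,m,\mathbf{e},s)$-system over $\mathbb{F}_q$, then $\delta_{m,\mathbf{e}}(\mathcal{C}^\perp)\ge d$. (b) If the matrices $C_1,\dots,C_s$ are all nonsingular and the system is a $(d,m,\mathbf{e},s)$-system over $\mathbb{F}_q$, then $\delta_{m,\mathbf{e}}(\mathcal{C}^\perp)\ge d+1$. (c) If $\delta_{m,\mathbf{e}}(\mathcal{C}^\perp)\ge d+1$, then the system is a $(d,m,\mathbf{e},s)$-system over $\mathbb{F}_q$.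
   Context: $\mathbb{N}$ denotes the positive integers. For $\mathbf{e}=(e_1,\dots,e_s)\in\mathbb{N}^s$ and $0\le d\le m$, a system $\{\mathbf{a}^{(i)}_j\in\mathbb{F}_q^m:1\le i\le s,1\le j\le m\}$ is a $(d,m,\mathbf{e},s)$-system over $\mathbb{F}_q$ if for any nonnegative integers $d_1,\dots,d_s$ with $e_i\mid d_i$ for all $i$ and $\sum_i d_i\le d$, the vectors $\mathbf{a}^{(i)}_j$, $1\le j\le d_i$, $1\le i\le s$, are linearly independent over $\mathbb{F}_q$ (trivially satisfied for $d=0$). The dual space of $\mathcal{C}$ is its orthogonal complement with respect to the standard dot product on $\mathbb{F}_q^{sm}$. For $\mathbf{a}=(a_1,\dots,a_m)\in\mathbb{F}_q^m$ and $e\in\mathbb{N}$, $v_e(\mathbf{a})=0$ if $\mathbf{a}=\mathbf{0}$ and $v_e(\mathbf{a})=\min\{m,e\lceil\max\{j:a_j\neq0\}/e\rceil\}$ otherwise. For $\mathbf{A}=(\mathbf{a}^{(1)},\dots,\mathbf{a}^{(s)})\in\mathbb{F}_q^{sm}$ with $\mathbf{a}^{(i)}\in\mathbb{F}_q^m$, $V_{m,\mathbf{e}}(\mathbf{A})=\sum_{i=1}^sv_{e_i}(\mathbf{a}^{(i)})$. For a linear subspace $\mathcal{N}\subseteq\mathbb{F}_q^{sm}$, $\delta_{m,\mathbf{e}}(\mathcal{N})=\min_{\mathbf{A}\in\mathcal{N}\setminus\{\mathbf{0}\}}V_{m,\mathbf{e}}(\mathbf{A})$ if $\mathcal{N}\neq\{\mathbf{0}\}$,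 and $sm+1$ otherwise. -}

module Defs where

open import Level using (Level; _⊔_) renaming (suc to lsuc)
open import Data.Nat as ℕ using (ℕ; zero; suc; _≤_; _<_; _⊓_; _^_; _/_)
open import Data.Nat.Divisibility using (_∣_)
open import Data.Nat.Primality using (Prime)
open import Data.Fin as Fin using (Fin; toℕ)
open import Data.Fin.Properties using () renaming (_≟_ to _≟ᶠ_)
open import Data.Product using (∃; ∃₂; _×_; _,_; proj₁; proj₂)
open import Data.Bool using (if_then_else_)
open import Function using (_∘_)
open import Function.Bundles using (Bijection)
open import Relation.Nullary using (¬_; Dec; yes; no; does)
open import Relation.Binary using (Decidable)
open import Relation.Binary.PropositionalEquality as ≡ using (_≡_)
open import Algebra.Bundles using (CommutativeRing)

IsPrimePower : ℕ → Set
IsPrimePower q = ∃₂ λ p k → Prime p × 1 ≤ k × q ≡ p ^ k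

record FiniteField (c ℓ : Level) (q : ℕ) : Set (lsuc (c ⊔ ℓ)) where
  field
    commRing : CommutativeRing c ℓ
  open CommutativeRing commRing public
  field
    0≉1     : ¬ (0# ≈ 1#)
    inverse : ∀ x → ¬ (x ≈ 0#) → ∃ λ y → x * y ≈ 1#
    card    : Bijection (≡.setoid (Fin q)) setoid

  _≟_ : Decidable _≈_
  x ≟ y with Bijection.strictlySurjective card x | Bijection.strictlySurjective card y
  ... | i , pi | j , pj with i ≟ᶠ j
  ...   | yes ≡.refl = yes (trans (sym pi) pj)
  ...   | no i≢j = no λ x≈y → i≢j (Bijection.injective card (trans pi (trans x≈y (sym pj))))

∑ℕ : ∀ {n} → (Fin n → ℕ) → ℕ
∑ℕ {zero}  f = 0
∑ℕ {suc n} f = f Fin.zero ℕ.+ ∑ℕ (f ∘ Fin.suc)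

-- ⌈ j / e ⌉ multiplied by e  (e ≥ 1; the value for e = 0 is never used)
ceilMul : ℕ → ℕ → ℕ
ceilMul zero    j = 0
ceilMul (suc e) j = suc e ℕ.* ((j ℕ.+ e) / suc e)

module _ {c ℓ : Level} {q : ℕ} (F : FiniteField c ℓ q) where
  open FiniteField F

  ∑ : ∀ {n} → (Fin n → Carrier) → Carrier
  ∑ {zero}  f = 0#
  ∑ {suc n} f = f Fin.zero + ∑ (f ∘ Fin.suc)

  -- max{ j : a_j ≠ 0 } with 1-based indices, and 0 iff a = 0
  maxNZ : ∀ {n} → (Fin n → Carrier) → ℕ
  maxNZ {zero}  a = 0
  maxNZ {suc n} a with maxNZ (a ∘ Fin.suc)
  ... | zero  = if does (a Fin.zero ≟ 0#) then 0 else 1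
  ... | suc r = suc (suc r)

  v : (m : ℕ) → ℕ → (Fin m → Carrier) → ℕ
  v m e a with maxNZ a
  ... | zero  = 0
  ... | suc j = m ⊓ ceilMul e (suc j)

  -- An element of F_q^{sm}, written A = (a^(1),…,a^(s)) with a^(i) ∈ F_q^m
  Vec-sm : ℕ → ℕ → Set c
  Vec-sm s m = Fin s → Fin m → Carrier

  V : (s m : ℕ) → (Fin s → ℕ) → Vec-sm s m → ℕ
  V s m e A = ∑ℕ (λ i → v m (e i) (A i))

  IsZero : ∀ {s m} → Vec-sm s m → Set ℓ
  IsZero A = ∀ i j → A i j ≈ 0#

  dot : ∀ {s m} → Vec-sm s m → Vec-sm s m → Carrier
  dot A B = ∑ (λ i → ∑ (λ j → A i j * B i j))

  -- δ_{m,e}(N) ≥ k, i.e. the minimum defining δ is at least k: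
  -- if N = {0} then sm+1 ≥ k, otherwise V(A) ≥ k for all nonzero A ∈ N.
  δ≥ : (s m : ℕ) → (Fin s → ℕ) → (Vec-sm s m → Set (c ⊔ ℓ)) → ℕ → Set (c ⊔ ℓ)
  δ≥ s m e N k =
      ((∀ A → N A → IsZero A) → k ≤ s ℕ.* m ℕ.+ 1)
    × (∀ A → N A → ¬ IsZero A → k ≤ V s m e A)

  -- A system {c^(i)_j ∈ F_q^m : 1 ≤ i ≤ s, 1 ≤ j ≤ m}:
  -- sys i j r is the r-th coordinate of c^(i)_j.
  System : ℕ → ℕ → Set c
  System s m = Fin s → Fin m → Fin m → Carrier

  -- the vectors c^(i)_j with 1 ≤ j ≤ d_i, 1 ≤ i ≤ s are linearly independent
  LinIndep : ∀ {s m} → System s m → (Fin s → ℕ) → Set (c ⊔ ℓ)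
  LinIndep {s} {m} sys dd =
    ∀ (λ′ : Fin s → Fin m → Carrier) →
      (∀ r → ∑ (λ i → ∑ (λ j →
                 if toℕ j ℕ.<ᵇ dd i then λ′ i j * sys i j r else 0#)) ≈ 0#) →
      ∀ i j → toℕ j < dd i → λ′ i j ≈ 0#

  IsSystem : (d m : ℕ) → ∀ {s} → (Fin s → ℕ) → System s m → Set (c ⊔ ℓ)
  IsSystem d m {s} e sys =
    ∀ (dd : Fin s → ℕ) → (∀ i → e i ∣ dd i) → ∑ℕ dd ≤ d → LinIndep sys dd

  Cmat : ∀ {s m} → System s m → Fin s → Fin m → Fin m → Carrier
  Cmat sys i r j = sys i j r

  _·_ : ∀ {m} → (Fin m → Fin m → Carrier) → (Fin m → Fin m → Carrier) → Fin m → Fin m → Carrier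
  (M · N) r t = ∑ (λ k → M r k * N k t)

  Id : ∀ {m} → Fin m → Fin m → Carrier
  Id r t = if does (r ≟ᶠ t) then 1# else 0#

  Nonsingular : ∀ {m} → (Fin m → Fin m → Carrier) → Set (c ⊔ ℓ)
  Nonsingular {m} M = ∃ λ (D : Fin m → Fin m → Carrier) →
    (∀ r t → (M · D) r t ≈ Id r t) × (∀ r t → (D · M) r t ≈ Id r t)

  RowSpace : ∀ {s m} → System s m → Vec-sm s m → Set (c ⊔ ℓ)
  RowSpace {s} {m} sys B = ∃ λ (λ′ : Fin m → Carrier) →
    ∀ i j → B i j ≈ ∑ (λ r → λ′ r * Cmat sys i r j)

  Dual : ∀ {s m} → System s m → Vec-sm s m → Set (c ⊔ ℓ)
  Dual sys A = ∀ B → RowSpace sys B → dot A B ≈ 0#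

module Submission where

-- Write A ∈ F_q^{sm} as blocks a^(i) and put
-- comb(A) = Σ_i Σ_j a^(i)_j c^(i)_j ∈ F_q^m.  Testing A against the rows of
-- C shows that A ∈ C^⊥ iff comb(A) = 0, i.e. the dual vectors are exactly
-- the linear dependencies of the system.  The support of block i lies
-- below its profile p_i(A) = e_i⌈maxNZ(a^(i))/e_i⌉, a multiple of e_i, and
-- V(A) = Σ_i min(m, p_i(A)).
--  (a) If A ∈ C^⊥ has V(A) < d ≤ m then no p_i exceeds m, so Σ p_i ≤ d and
--      the (d,m,e,s)-property applied to (p_i) forces A = 0.
--  (b) If V(A) ≤ d but Σ p_i > d, some p_i exceeds m; then V(A) = m and all
--      other blocks vanish, so a^(i) is a dependency among the columns of
--      C_i, which is zero when C_i is nonsingular.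
--  (c) A dependency supported on the first d_i vectors of each block, with
--      e_i ∣ d_i, is a dual vector of weight V ≤ Σ d_i ≤ d < d + 1, so zero.

open import Defs
open import Level using (Level; _⊔_)
open import Data.Nat as ℕ using (ℕ; zero; suc; _≤_; _<_; _⊓_; _<ᵇ_; z≤n; s≤s)
import Data.Nat.Properties as ℕP
open import Data.Nat.Divisibility using (_∣_; divides)
open import Data.Fin as Fin using (Fin; toℕ)
open import Data.Fin.Properties using (punchInᵢ≢i) renaming (_≟_ to _≟ᶠ_)
open import Data.Product using (∃; _×_; _,_)
open import Data.Bool using (true; false; if_then_else_)
open import Data.Empty using (⊥-elim)
open import Function using (_∘_)
open import Relation.Nullary using (¬_; yes; no)
open import Relation.Binary.PropositionalEquality as ≡ using (_≡_; _≢_)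

module NatFacts where

  open import Data.Nat
  open import Data.Nat.Properties
  open import Data.Nat.DivMod

  ceilMul-∣ : ∀ e j → e ∣ ceilMul e j
  ceilMul-∣ zero    j = divides 0 ≡.refl
  ceilMul-∣ (suc e) j = divides ((j + e) / suc e) (*-comm (suc e) _)

  ceilMul-≥ : ∀ {e} → 1 ≤ e → ∀ j → j ≤ ceilMul e j
  ceilMul-≥ {suc e} _ j =
    ≡.subst (j ≤_) (*-comm ((j + e) / suc e) (suc e)) (+-cancelʳ-≤ e j _ j+e≤)
    where
    open ≤-Reasoning
    j+e≤ : j + e ≤ (j + e) / suc e * suc e + e
    j+e≤ = begin
      j + e                                      ≡⟨ m≡m%n+[m/n]*n (j + e) (suc e) ⟩
      (j + e) % suc e + (j + e) / suc e * suc e  ≤⟨ +-monoˡ-≤ _ (≤-pred (m%n<n (j + e) (suc e))) ⟩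
      e + (j + e) / suc e * suc e                ≡⟨ +-comm e _ ⟩
      (j + e) / suc e * suc e + e                ∎

  ceilMul-least : ∀ {e t} → 1 ≤ e → e ∣ t → ∀ {j} → j ≤ t → ceilMul e j ≤ t
  ceilMul-least {suc e} _ (divides k ≡.refl) {j} j≤t =
    ≡.subst (_≤ k * suc e) (*-comm ((j + e) / suc e) (suc e)) (*-monoˡ-≤ (suc e) quot≤k)
    where
    open ≤-Reasoning
    quot≤k : (j + e) / suc e ≤ k
    quot≤k = begin
      (j + e) / suc e                    ≤⟨ /-monoˡ-≤ (suc e) (+-monoˡ-≤ e j≤t) ⟩
      (k * suc e + e) / suc e            ≡⟨ +-distrib-/-∣ˡ e (divides k ≡.refl) ⟩
      k * suc e / suc e + e / suc e      ≡⟨ ≡.cong₂ _+_ (m*n/n≡m k (suc e)) (m<n⇒m/n≡0 (n<1+n e)) ⟩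
      k + 0                              ≡⟨ +-identityʳ k ⟩
      k                                  ∎

  ceilMul-zero : ∀ e → ceilMul e 0 ≡ 0
  ceilMul-zero zero    = ≡.refl
  ceilMul-zero (suc e) = ≡.trans (≡.cong (suc e *_) (m<n⇒m/n≡0 (n<1+n e))) (*-zeroʳ (suc e))

  m⊓n≡0⇒n≡0 : ∀ {m n} → 1 ≤ m → m ⊓ n ≡ 0 → n ≡ 0
  m⊓n≡0⇒n≡0 {suc m} {zero}  _ _  = ≡.refl
  m⊓n≡0⇒n≡0 {suc m} {suc n} _ ()

  ∑ℕ-cong : ∀ {n} {f g : Fin n → ℕ} → (∀ i → f i ≡ g i) → ∑ℕ f ≡ ∑ℕ g
  ∑ℕ-cong {zero}  h = ≡.refl
  ∑ℕ-cong {suc n} h = ≡.cong₂ _+_ (h Fin.zero) (∑ℕ-cong (h ∘ Fin.suc))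

  ∑ℕ-mono : ∀ {n} {f g : Fin n → ℕ} → (∀ i → f i ≤ g i) → ∑ℕ f ≤ ∑ℕ g
  ∑ℕ-mono {zero}  h = z≤n
  ∑ℕ-mono {suc n} h = +-mono-≤ (h Fin.zero) (∑ℕ-mono (h ∘ Fin.suc))

  ∑ℕ-term : ∀ {n} (f : Fin n → ℕ) i → f i ≤ ∑ℕ f
  ∑ℕ-term f Fin.zero    = m≤m+n _ _
  ∑ℕ-term f (Fin.suc i) = ≤-trans (∑ℕ-term (f ∘ Fin.suc) i) (m≤n+m _ _)

  ∑ℕ-two-terms : ∀ {n} (f : Fin n → ℕ) i k → i ≢ k → f i + f k ≤ ∑ℕ f
  ∑ℕ-two-terms f Fin.zero    Fin.zero    i≢k = ⊥-elim (i≢k ≡.refl)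
  ∑ℕ-two-terms f Fin.zero    (Fin.suc k) i≢k = +-monoʳ-≤ (f Fin.zero) (∑ℕ-term (f ∘ Fin.suc) k)
  ∑ℕ-two-terms f (Fin.suc i) Fin.zero    i≢k =
    ≡.subst (_≤ ∑ℕ f) (+-comm (f Fin.zero) (f (Fin.suc i)))
      (+-monoʳ-≤ (f Fin.zero) (∑ℕ-term (f ∘ Fin.suc) i))
  ∑ℕ-two-terms f (Fin.suc i) (Fin.suc k) i≢k =
    ≤-trans (∑ℕ-two-terms (f ∘ Fin.suc) i k (i≢k ∘ ≡.cong Fin.suc)) (m≤n+m _ _)

  ∑ℕ-others-zero : ∀ {n b} (f : Fin n → ℕ) {i k} → k ≢ i → b ≤ f i → ∑ℕ f ≤ b → f k ≡ 0
  ∑ℕ-others-zero {b = b} f {i} {k} k≢i b≤fᵢ ∑≤b = n≤0⇒n≡0 (+-cancelʳ-≤ b (f k) 0 fₖ+b≤b)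
    where
    open ≤-Reasoning
    fₖ+b≤b : f k + b ≤ b
    fₖ+b≤b = begin
      f k + b    ≤⟨ +-monoʳ-≤ (f k) b≤fᵢ ⟩
      f k + f i  ≤⟨ ∑ℕ-two-terms f k i k≢i ⟩
      ∑ℕ f       ≤⟨ ∑≤b ⟩
      b          ∎

  ∑ℕ-capped : ∀ {n} m (f : Fin n → ℕ) → ∑ℕ (λ i → m ⊓ f i) < ∑ℕ f → ∃ λ i → m < f i
  ∑ℕ-capped {zero}  m f ()
  ∑ℕ-capped {suc n} m f lt with m <? f Fin.zero
  ... | yes m<f₀ = Fin.zero , m<f₀
  ... | no  m≮f₀ with ∑ℕ-capped m (f ∘ Fin.suc) (+-cancelˡ-< (f Fin.zero) _ _ tail<)
    where
    tail< : f Fin.zero + ∑ℕ (λ i → m ⊓ f (Fin.suc i)) < ∑ℕ f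
    tail< = ≡.subst (λ x → x + ∑ℕ (λ i → m ⊓ f (Fin.suc i)) < ∑ℕ f) (m≥n⇒m⊓n≡n (≮⇒≥ m≮f₀)) lt
  ...   | i , m<fᵢ = Fin.suc i , m<fᵢ

open NatFacts

module FieldAlgebra {c ℓ : Level} {q : ℕ} (F : FiniteField c ℓ q) where

  open FiniteField F
  open import Algebra.Properties.Semiring.Sum semiring as Lib using (sum)
  open import Relation.Binary.Reasoning.Setoid setoid

  ∑≡sum : ∀ {n} (f : Fin n → Carrier) → ∑ F f ≡ sum f
  ∑≡sum {zero}  f = ≡.refl
  ∑≡sum {suc n} f = ≡.cong (f Fin.zero +_) (∑≡sum (f ∘ Fin.suc))

  ∑-cong : ∀ {n} {f g : Fin n → Carrier} → (∀ k → f k ≈ g k) → ∑ F f ≈ ∑ F g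
  ∑-cong {f = f} {g} f≈g = begin
    ∑ F f  ≡⟨ ∑≡sum f ⟩
    sum f  ≈⟨ Lib.sum-cong-≋ f≈g ⟩
    sum g  ≡⟨ ≡.sym (∑≡sum g) ⟩
    ∑ F g  ∎

  ∑-zero : ∀ {n} {f : Fin n → Carrier} → (∀ k → f k ≈ 0#) → ∑ F f ≈ 0#
  ∑-zero {n} {f} f≈0 = begin
    ∑ F f              ≈⟨ ∑-cong f≈0 ⟩
    ∑ F {n} (λ _ → 0#) ≡⟨ ∑≡sum {n} (λ _ → 0#) ⟩
    sum {n} (λ _ → 0#) ≈⟨ Lib.sum-replicate-zero n ⟩
    0#                 ∎

  ∑-*ˡ : ∀ {n} x (f : Fin n → Carrier) → x * ∑ F f ≈ ∑ F (λ k → x * f k)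
  ∑-*ˡ x f = begin
    x * ∑ F f              ≡⟨ ≡.cong (x *_) (∑≡sum f) ⟩
    x * sum f              ≈⟨ Lib.*-distribˡ-sum x f ⟩
    sum (λ k → x * f k)    ≡⟨ ≡.sym (∑≡sum (λ k → x * f k)) ⟩
    ∑ F (λ k → x * f k)    ∎

  ∑-*ʳ : ∀ {n} x (f : Fin n → Carrier) → ∑ F f * x ≈ ∑ F (λ k → f k * x)
  ∑-*ʳ x f = begin
    ∑ F f * x              ≡⟨ ≡.cong (_* x) (∑≡sum f) ⟩
    sum f * x              ≈⟨ Lib.*-distribʳ-sum x f ⟩
    sum (λ k → f k * x)    ≡⟨ ≡.sym (∑≡sum (λ k → f k * x)) ⟩
    ∑ F (λ k → f k * x)    ∎

  ∑∑≈sumsum : ∀ {n p} (f : Fin n → Fin p → Carrier) →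
              ∑ F (λ i → ∑ F (f i)) ≈ sum (λ i → sum (f i))
  ∑∑≈sumsum f = begin
    ∑ F (λ i → ∑ F (f i))  ≡⟨ ∑≡sum (λ i → ∑ F (f i)) ⟩
    sum (λ i → ∑ F (f i))  ≈⟨ Lib.sum-cong-≋ (λ i → reflexive (∑≡sum (f i))) ⟩
    sum (λ i → sum (f i))  ∎

  ∑-comm : ∀ {n p} (f : Fin n → Fin p → Carrier) →
           ∑ F (λ i → ∑ F (f i)) ≈ ∑ F (λ j → ∑ F (λ i → f i j))
  ∑-comm f = begin
    ∑ F (λ i → ∑ F (f i))               ≈⟨ ∑∑≈sumsum f ⟩
    sum (λ i → sum (f i))               ≈⟨ Lib.∑-comm f ⟩
    sum (λ j → sum (λ i → f i j))       ≈⟨ sym (∑∑≈sumsum (λ j i → f i j)) ⟩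
    ∑ F (λ j → ∑ F (λ i → f i j))       ∎

  ∑-single : ∀ {n} (f : Fin n → Carrier) i → (∀ k → k ≢ i → f k ≈ 0#) → ∑ F f ≈ f i
  ∑-single {suc n} f i others≈0 = begin
    ∑ F f                                   ≡⟨ ∑≡sum f ⟩
    sum f                                   ≈⟨ Lib.sum-remove f ⟩
    f i + sum (f ∘ Fin.punchIn i)           ≈⟨ +-congˡ (sym (reflexive (∑≡sum (f ∘ Fin.punchIn i)))) ⟩
    f i + ∑ F (f ∘ Fin.punchIn i)           ≈⟨ +-congˡ (∑-zero (λ k → others≈0 _ (punchInᵢ≢i i k))) ⟩
    f i + 0#                                ≈⟨ +-identityʳ (f i) ⟩
    f i                                     ∎

  Id-sum : ∀ {m} (t : Fin m) (g : Fin m → Carrier) → ∑ F (λ r → Id F t r * g r) ≈ g t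
  Id-sum t g = trans (∑-single _ t off-diagonal) (trans (*-congʳ (reflexive (Id-diag t))) (*-identityˡ (g t)))
    where
    Id-diag : ∀ {m} (t : Fin m) → Id F t t ≡ 1#
    Id-diag t with t ≟ᶠ t
    ... | yes _   = ≡.refl
    ... | no  t≢t = ⊥-elim (t≢t ≡.refl)
    Id-off : ∀ {m} (t r : Fin m) → r ≢ t → Id F t r ≡ 0#
    Id-off t r r≢t with t ≟ᶠ r
    ... | yes t≡r = ⊥-elim (r≢t (≡.sym t≡r))
    ... | no  _   = ≡.refl
    off-diagonal : ∀ r → r ≢ t → Id F t r * g r ≈ 0#
    off-diagonal r r≢t = trans (*-congʳ (reflexive (Id-off t r r≢t))) (zeroˡ (g r))

  nonsingular-injective : ∀ {m} {M : Fin m → Fin m → Carrier} → Nonsingular F M →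
    (a : Fin m → Carrier) → (∀ r → ∑ F (λ j → M r j * a j) ≈ 0#) → ∀ t → a t ≈ 0#
  nonsingular-injective {M = M} (D , _ , DM≈Id) a Ma≈0 t = begin
    a t                                           ≈⟨ sym (Id-sum t a) ⟩
    ∑ F (λ j → Id F t j * a j)                    ≈⟨ ∑-cong (λ j → *-congʳ (sym (DM≈Id t j))) ⟩
    ∑ F (λ j → ∑ F (λ k → D t k * M k j) * a j)   ≈⟨ ∑-cong (λ j → ∑-*ʳ (a j) (λ k → D t k * M k j)) ⟩
    ∑ F (λ j → ∑ F (λ k → D t k * M k j * a j))   ≈⟨ ∑-cong (λ j → ∑-cong (λ k → *-assoc (D t k) (M k j) (a j))) ⟩
    ∑ F (λ j → ∑ F (λ k → D t k * (M k j * a j))) ≈⟨ ∑-comm (λ j k → D t k * (M k j * a j)) ⟩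
    ∑ F (λ k → ∑ F (λ j → D t k * (M k j * a j))) ≈⟨ ∑-cong (λ k → sym (∑-*ˡ (D t k) (λ j → M k j * a j))) ⟩
    ∑ F (λ k → D t k * ∑ F (λ j → M k j * a j))   ≈⟨ ∑-zero (λ k → trans (*-congˡ (Ma≈0 k)) (zeroʳ (D t k))) ⟩
    0#                                            ∎

module Support {c ℓ : Level} {q : ℕ} (F : FiniteField c ℓ q) where

  open FiniteField F

  maxNZ-vanishes : ∀ {n} (a : Fin n → Carrier) k → maxNZ F a ≤ toℕ k → a k ≈ 0#
  maxNZ-vanishes {suc n} a k bound
    with maxNZ F (a ∘ Fin.suc) | maxNZ-vanishes (a ∘ Fin.suc)
  maxNZ-vanishes {suc n} a Fin.zero _ | zero | _ with a Fin.zero ≟ 0#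
  ... | yes a₀≈0 = a₀≈0
  maxNZ-vanishes {suc n} a Fin.zero ()    | zero | _ | no _
  maxNZ-vanishes {suc n} a (Fin.suc k) _  | zero  | tail-vanishes = tail-vanishes k z≤n
  maxNZ-vanishes {suc n} a Fin.zero ()    | suc r | _
  maxNZ-vanishes {suc n} a (Fin.suc k) (s≤s bound) | suc r | tail-vanishes = tail-vanishes k bound

  maxNZ-least : ∀ {n} (a : Fin n → Carrier) b → (∀ k → b ≤ toℕ k → a k ≈ 0#) → maxNZ F a ≤ b
  maxNZ-least {zero}  a b vanish = z≤n
  maxNZ-least {suc n} a zero vanish
    with maxNZ F (a ∘ Fin.suc) | maxNZ-least (a ∘ Fin.suc) 0 (λ k _ → vanish (Fin.suc k) z≤n)
  ... | zero | _ with a Fin.zero ≟ 0#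
  ...   | yes _    = z≤n
  ...   | no a₀≉0 = ⊥-elim (a₀≉0 (vanish Fin.zero z≤n))
  maxNZ-least {suc n} a zero vanish | suc r | ()
  maxNZ-least {suc n} a (suc b) vanish
    with maxNZ F (a ∘ Fin.suc) | maxNZ-least (a ∘ Fin.suc) b (λ k b≤k → vanish (Fin.suc k) (s≤s b≤k))
  ... | zero | _ with a Fin.zero ≟ 0#
  ...   | yes _ = z≤n
  ...   | no _  = s≤s z≤n
  maxNZ-least {suc n} a (suc b) vanish | suc r | tail≤b = s≤s tail≤b

  v-capped : ∀ m e (a : Fin m → Carrier) → v F m e a ≡ m ⊓ ceilMul e (maxNZ F a)
  v-capped m e a with maxNZ F a
  ... | zero  = ≡.sym (≡.trans (≡.cong (m ⊓_) (ceilMul-zero e)) (ℕP.⊓-zeroʳ m))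
  ... | suc j = ≡.refl

module Parts {c ℓ : Level} {q : ℕ} (F : FiniteField c ℓ q)
             (s m : ℕ) (m≥1 : 1 ≤ m) (e : Fin s → ℕ) (e≥1 : ∀ i → 1 ≤ e i)
             (sys : System F s m) where

  open FiniteField F
  open FieldAlgebra F
  open Support F
  open import Algebra.Properties.CommutativeSemigroup *-commutativeSemigroup using (x∙yz≈y∙xz)
  open import Relation.Binary.Reasoning.Setoid setoid

  comb : Vec-sm F s m → Fin m → Carrier
  comb A r = ∑ F (λ i → ∑ F (λ j → A i j * sys i j r))

  dot-rowSpace : ∀ A (μ : Fin m → Carrier) →
    dot F A (λ i j → ∑ F (λ r → μ r * Cmat F sys i r j)) ≈ ∑ F (λ r → μ r * comb A r)
  dot-rowSpace A μ = begin
    ∑ F (λ i → ∑ F (λ j → A i j * ∑ F (λ r → μ r * sys i j r)))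
      ≈⟨ ∑-cong (λ i → ∑-cong (λ j → trans (∑-*ˡ (A i j) (λ r → μ r * sys i j r))
                                           (∑-cong (λ r → x∙yz≈y∙xz (A i j) (μ r) (sys i j r))))) ⟩
    ∑ F (λ i → ∑ F (λ j → ∑ F (λ r → μ r * (A i j * sys i j r))))
      ≈⟨ ∑-cong (λ i → ∑-comm (λ j r → μ r * (A i j * sys i j r))) ⟩
    ∑ F (λ i → ∑ F (λ r → ∑ F (λ j → μ r * (A i j * sys i j r))))
      ≈⟨ ∑-comm (λ i r → ∑ F (λ j → μ r * (A i j * sys i j r))) ⟩
    ∑ F (λ r → ∑ F (λ i → ∑ F (λ j → μ r * (A i j * sys i j r))))
      ≈⟨ ∑-cong (λ r → sym (trans (∑-*ˡ (μ r) (λ i → ∑ F (λ j → A i j * sys i j r)))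
                                  (∑-cong (λ i → ∑-*ˡ (μ r) (λ j → A i j * sys i j r))))) ⟩
    ∑ F (λ r → μ r * comb A r)
      ∎

  -- A ∈ C^⊥ iff comb(A) = 0: test against the rows of C, resp. expand a row-space vector
  dual⇒comb≈0 : ∀ A → Dual F sys A → ∀ r → comb A r ≈ 0#
  dual⇒comb≈0 A dual r = dual (λ i j → sys i j r) (Id F r , λ i j → sym (Id-sum r (λ r′ → sys i j r′)))

  comb≈0⇒dual : ∀ A → (∀ r → comb A r ≈ 0#) → Dual F sys A
  comb≈0⇒dual A comb≈0 B (μ , B≈μC) = begin
    dot F A B                                               ≈⟨ ∑-cong (λ i → ∑-cong (λ j → *-congˡ (B≈μC i j))) ⟩
    dot F A (λ i j → ∑ F (λ r → μ r * Cmat F sys i r j))    ≈⟨ dot-rowSpace A μ ⟩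
    ∑ F (λ r → μ r * comb A r)                              ≈⟨ ∑-zero (λ r → trans (*-congˡ (comb≈0 r)) (zeroʳ (μ r))) ⟩
    0#                                                      ∎

  profile : Vec-sm F s m → Fin s → ℕ
  profile A i = ceilMul (e i) (maxNZ F (A i))

  profile-vanishes : ∀ A i j → profile A i ≤ toℕ j → A i j ≈ 0#
  profile-vanishes A i j p≤j = maxNZ-vanishes (A i) j (ℕP.≤-trans (ceilMul-≥ (e≥1 i) _) p≤j)

  V-capped : ∀ A → V F s m e A ≡ ∑ℕ (λ i → m ⊓ profile A i)
  V-capped A = ∑ℕ-cong (λ i → v-capped m (e i) (A i))

  truncate : (Fin s → ℕ) → Vec-sm F s m → Vec-sm F s m
  truncate dd λ′ i j = if toℕ j <ᵇ dd i then λ′ i j else 0#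

  comb-truncate : ∀ dd λ′ r → comb (truncate dd λ′) r ≈
    ∑ F (λ i → ∑ F (λ j → if toℕ j <ᵇ dd i then λ′ i j * sys i j r else 0#))
  comb-truncate dd λ′ r = ∑-cong (λ i → ∑-cong (λ j → term i j))
    where
    term : ∀ i j → truncate dd λ′ i j * sys i j r ≈ (if toℕ j <ᵇ dd i then λ′ i j * sys i j r else 0#)
    term i j with toℕ j <ᵇ dd i
    ... | true  = refl
    ... | false = zeroˡ (sys i j r)

  truncate-below : ∀ dd λ′ i j → toℕ j < dd i → truncate dd λ′ i j ≡ λ′ i j
  truncate-below dd λ′ i j below with toℕ j <ᵇ dd i | ℕP.<⇒<ᵇ below
  ... | true | _ = ≡.refl

  truncate-beyond : ∀ dd λ′ i j → dd i ≤ toℕ j → truncate dd λ′ i j ≈ 0#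
  truncate-beyond dd λ′ i j beyond with toℕ j <ᵇ dd i | ℕP.<ᵇ⇒< (toℕ j) (dd i)
  ... | true  | below = ⊥-elim (ℕP.<⇒≱ (below _) beyond)
  ... | false | _     = refl

  truncate-profile : ∀ A i j → truncate (profile A) A i j ≈ A i j
  truncate-profile A i j with toℕ j ℕ.<? profile A i
  ... | yes below = reflexive (truncate-below (profile A) A i j below)
  ... | no  ¬below = trans (truncate-beyond (profile A) A i j (ℕP.≮⇒≥ ¬below))
                           (sym (profile-vanishes A i j (ℕP.≮⇒≥ ¬below)))

  -- a dual vector whose profiles sum to at most d is a dependency that the
  -- (d,m,e,s)-property rules out
  dual-small-profile⇒zero : ∀ {d} → IsSystem F d m e sys → ∀ A → Dual F sys A →
                            ∑ℕ (profile A) ≤ d → IsZero F A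
  dual-small-profile⇒zero isSystem A dual ∑p≤d i j with toℕ j ℕ.<? profile A i
  ... | yes below = isSystem (profile A) (λ i → ceilMul-∣ (e i) _) ∑p≤d A masked≈0 i j below
    where
    masked≈0 : ∀ r → ∑ F (λ i → ∑ F (λ j →
                 if toℕ j <ᵇ profile A i then A i j * sys i j r else 0#)) ≈ 0#
    masked≈0 r = begin
      _                                 ≈⟨ sym (comb-truncate (profile A) A r) ⟩
      comb (truncate (profile A) A) r   ≈⟨ ∑-cong (λ i → ∑-cong (λ j → *-congʳ (truncate-profile A i j))) ⟩
      comb A r                          ≈⟨ dual⇒comb≈0 A dual r ⟩
      0#                                ∎
  ... | no ¬below = profile-vanishes A i j (ℕP.≮⇒≥ ¬below)

  saturated-block : ∀ {d} A → V F s m e A ≤ d → ¬ ∑ℕ (profile A) ≤ d → ∃ λ i → m < profile A i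
  saturated-block {d} A V≤d ∑p≰d =
    ∑ℕ-capped m (profile A) (ℕP.≤-<-trans (≡.subst (_≤ d) (V-capped A) V≤d) (ℕP.≰⇒> ∑p≰d))

  saturated⇒m≤V : ∀ A i → m < profile A i → m ≤ V F s m e A
  saturated⇒m≤V A i m<p = ≡.subst₂ _≤_ (ℕP.m≤n⇒m⊓n≡m (ℕP.<⇒≤ m<p)) (≡.sym (V-capped A))
                            (∑ℕ-term (λ k → m ⊓ profile A k) i)

  saturated⇒others-vanish : ∀ A i → m < profile A i → V F s m e A ≤ m →
                            ∀ k → k ≢ i → ∀ j → A k j ≈ 0#
  saturated⇒others-vanish A i m<p V≤m k k≢i j =
    profile-vanishes A k j (≡.subst (_≤ toℕ j) (≡.sym profile≡0) z≤n)
    where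
    capped-sum≤m : ∑ℕ (λ k → m ⊓ profile A k) ≤ m
    capped-sum≤m = ≡.subst (_≤ m) (V-capped A) V≤m
    profile≡0 : profile A k ≡ 0
    profile≡0 = m⊓n≡0⇒n≡0 m≥1 (∑ℕ-others-zero (λ k → m ⊓ profile A k) k≢i
                  (ℕP.≤-reflexive (≡.sym (ℕP.m≤n⇒m⊓n≡m (ℕP.<⇒≤ m<p)))) capped-sum≤m)

  single-block-comb : ∀ A i → (∀ k → k ≢ i → ∀ j → A k j ≈ 0#) →
                      ∀ r → comb A r ≈ ∑ F (λ j → Cmat F sys i r j * A i j)
  single-block-comb A i others≈0 r = begin
    comb A r                                ≈⟨ ∑-single _ i (λ k k≢i → ∑-zero (λ j →
                                                 trans (*-congʳ (others≈0 k k≢i j)) (zeroˡ _))) ⟩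
    ∑ F (λ j → A i j * sys i j r)           ≈⟨ ∑-cong (λ j → *-comm (A i j) (sys i j r)) ⟩
    ∑ F (λ j → Cmat F sys i r j * A i j)    ∎

  δ≥-intro : ∀ (N : Vec-sm F s m → Set (c ⊔ ℓ)) k → 1 ≤ s → k ≤ suc m →
             (∀ A → N A → V F s m e A < k → IsZero F A) → δ≥ F s m e N k
  δ≥-intro N k s≥1 k≤1+m light⇒zero = (λ _ → k≤sm+1) , heavy
    where
    k≤sm+1 : k ≤ s ℕ.* m ℕ.+ 1
    k≤sm+1 = ℕP.≤-trans k≤1+m (≡.subst (suc m ≤_) (ℕP.+-comm 1 (s ℕ.* m))
               (s≤s (ℕP.≤-trans (ℕP.≤-reflexive (≡.sym (ℕP.*-identityˡ m))) (ℕP.*-monoˡ-≤ m s≥1))))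
    heavy : ∀ A → N A → ¬ IsZero F A → k ≤ V F s m e A
    heavy A inN nonzero with k ℕ.≤? V F s m e A
    ... | yes k≤V = k≤V
    ... | no  k≰V = ⊥-elim (nonzero (light⇒zero A inN (ℕP.≰⇒> k≰V)))

  part-a : ∀ {d} → d ≤ m → IsSystem F d m e sys → ∀ A → Dual F sys A → V F s m e A < d → IsZero F A
  part-a {d} d≤m isSystem A dual V<d with ∑ℕ (profile A) ℕ.≤? d
  ... | yes ∑p≤d = dual-small-profile⇒zero isSystem A dual ∑p≤d
  ... | no  ∑p≰d with saturated-block A (ℕP.<⇒≤ V<d) ∑p≰d
  ...   | i , m<p = ⊥-elim (ℕP.<-irrefl ≡.refl
                      (ℕP.≤-<-trans (saturated⇒m≤V A i m<p) (ℕP.<-≤-trans V<d d≤m)))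

  -- part (b): with nonsingular C_i even weight d forces zero, since the only
  -- new case is a single saturated block, killed by C_i
  part-b : ∀ {d} → d ≤ m → (∀ i → Nonsingular F (Cmat F sys i)) → IsSystem F d m e sys →
           ∀ A → Dual F sys A → V F s m e A ≤ d → IsZero F A
  part-b {d} d≤m nonsingular isSystem A dual V≤d with ∑ℕ (profile A) ℕ.≤? d
  ... | yes ∑p≤d = dual-small-profile⇒zero isSystem A dual ∑p≤d
  ... | no  ∑p≰d with saturated-block A V≤d ∑p≰d
  ...   | i , m<p = λ k j → block-zero k j
    where
    others≈0 : ∀ k → k ≢ i → ∀ j → A k j ≈ 0#
    others≈0 = saturated⇒others-vanish A i m<p (ℕP.≤-trans V≤d d≤m)
    block-zero : ∀ k j → A k j ≈ 0#
    block-zero k j with k ≟ᶠ i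
    ... | no  k≢i    = others≈0 k k≢i j
    ... | yes ≡.refl = nonsingular-injective (nonsingular k) (A k)
                         (λ r → trans (sym (single-block-comb A k others≈0 r)) (dual⇒comb≈0 A dual r)) j

  -- part (c): a dependency within the admissible prefixes is a dual vector of weight ≤ d
  part-c : ∀ {d} → δ≥ F s m e (Dual F sys) (suc d) → IsSystem F d m e sys
  part-c {d} (_ , heavy) dd e∣dd ∑dd≤d λ′ masked≈0 i j below with λ′ i j ≟ 0#
  ... | yes λ≈0 = λ≈0
  ... | no  λ≉0 = ⊥-elim (ℕP.<-irrefl ≡.refl (ℕP.<-≤-trans (heavy A dual nonzero) V≤d))
    where
    A : Vec-sm F s m
    A = truncate dd λ′
    dual : Dual F sys A
    dual = comb≈0⇒dual A (λ r → trans (comb-truncate dd λ′ r) (masked≈0 r))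
    nonzero : ¬ IsZero F A
    nonzero A≈0 = λ≉0 (trans (reflexive (≡.sym (truncate-below dd λ′ i j below))) (A≈0 i j))
    profile≤dd : ∀ k → m ⊓ profile A k ≤ dd k
    profile≤dd k = ℕP.≤-trans (ℕP.m⊓n≤n m _) (ceilMul-least (e≥1 k) (e∣dd k)
                     (maxNZ-least (A k) (dd k) (truncate-beyond dd λ′ k)))
    V≤d : V F s m e A ≤ d
    V≤d = ≡.subst (_≤ d) (≡.sym (V-capped A)) (ℕP.≤-trans (∑ℕ-mono profile≤dd) ∑dd≤d)

theorem6 : ∀ {c ℓ : Level} (q : ℕ) → IsPrimePower q → (F : FiniteField c ℓ q) →
    (s m : ℕ) → 1 ≤ s → 1 ≤ m → (e : Fin s → ℕ) → (∀ i → 1 ≤ e i) →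
    (sys : System F s m) → (d : ℕ) → d ≤ m →
      (IsSystem F d m e sys → δ≥ F s m e (Dual F sys) d)
    × ((∀ i → Nonsingular F (Cmat F sys i)) → IsSystem F d m e sys →
         δ≥ F s m e (Dual F sys) (suc d))
    × (δ≥ F s m e (Dual F sys) (suc d) → IsSystem F d m e sys)
theorem6 q _ F s m s≥1 m≥1 e e≥1 sys d d≤m =
    (λ isSystem → δ≥-intro (Dual F sys) d s≥1 (ℕP.m≤n⇒m≤1+n d≤m) (part-a d≤m isSystem))
  , (λ nonsingular isSystem → δ≥-intro (Dual F sys) (suc d) s≥1 (s≤s d≤m)
       (λ A dual V<1+d → part-b d≤m nonsingular isSystem A dual (ℕP.≤-pred V<1+d)))
  , part-c
  where open Parts F s m m≥1 e e≥1 sys
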